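{- For every integer $c\ge1$, there is a graph $G$ with ${\sf bd}(G)\le c$ that contains an inclusion-wise minimal blocking set of size $2^c$.
   Context: All graphs are finite, undirected, simple. $\alpha(G)$ is the independence number; $Y\subseteq V(G)$ is a blocking set in $G$ if $\alpha(G\setminus Y)<\alpha(G)$. Bridge-depth: an edge is a bridge if its removal increases the number of connected components; $\bar G$ is obtained from $G$ by contracting all bridges; ${\sf bd}(G)=0$ for the empty graph, the maximum over components for disconnected $G$, and $1+\min_{v\in V(\bar G)}{\sf bd}(\bar G\setminus v)$ for connected nonempty $G$. -}

module Defs where

open import Level using (0ℓ)
open import Data.Nat using (ℕ; zero; suc; _⊔_)
open import Data.Bool using (Bool; true; false)
open import Data.Fin using (Fin)
open import Data.Fin.Properties using (all?)
open import Data.Fin.Subset using (Subset; _∈_; _⊆_; ∣_∣; ⊤; ∁; inside; outside)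
open import Data.Fin.Subset.Properties using (_∈?_; _⊆?_)
open import Data.Vec using (_∷_; [])
open import Data.List using (List; []; _∷_; map; filter; foldr; _++_)
open import Data.Product using (Σ; Σ-syntax; ∃; _×_; _,_; proj₁; proj₂)
open import Data.Sum using (_⊎_; inj₁; inj₂)
open import Data.Empty using (⊥)
open import Relation.Nullary using (¬_; Dec; yes; no)
open import Relation.Nullary.Decidable using (_×-dec_; _→-dec_; ¬?)
open import Relation.Binary using (IsEquivalence)
open import Relation.Binary.PropositionalEquality
  using (_≡_; refl; sym; trans; subst; subst₂; isEquivalence)

record SimpleGraph (n : ℕ) : Set where
  field
    adj     : Fin n → Fin n → Bool
    adj-sym : ∀ i j → adj i j ≡ adj j i
    adj-irr : ∀ i → adj i i ≡ false

open SimpleGraph public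

Independent : ∀ {n} → SimpleGraph n → Subset n → Set
Independent G S = ∀ i j → i ∈ S → j ∈ S → adj G i j ≡ false

independent? : ∀ {n} (G : SimpleGraph n) (S : Subset n) → Dec (Independent G S)
independent? G S =
  all? λ i → all? λ j →
    (i ∈? S) →-dec ((j ∈? S) →-dec (Data.Bool._≟_ (adj G i j) false))
  where import Data.Bool

allSubsets : ∀ n → List (Subset n)
allSubsets zero    = [] ∷ []
allSubsets (suc n) = map (outside ∷_) (allSubsets n) ++ map (inside ∷_) (allSubsets n)

maximum : List ℕ → ℕ
maximum = foldr _⊔_ 0

α[_on_] : ∀ {n} → SimpleGraph n → Subset n → ℕ
α[ G on U ] =
  maximum (map ∣_∣ (filter (λ S → (S ⊆? U) ×-dec independent? G S) (allSubsets _)))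

α : ∀ {n} → SimpleGraph n → ℕ
α G = α[ G on ⊤ ]

Blocking : ∀ {n} → SimpleGraph n → Subset n → Set
Blocking G Y = α[ G on ∁ Y ] Data.Nat.< α G

MinimalBlocking : ∀ {n} → SimpleGraph n → Subset n → Set
MinimalBlocking G Y = Blocking G Y × (∀ Z → Z Data.Fin.Subset.⊂ Y → ¬ Blocking G Z)

-- General graphs on setoids (vertices = equivalence classes), used to
-- express contraction of bridges without quotient types.

record SGraph : Set₁ where
  field
    V       : Set
    _≈_     : V → V → Set
    ≈-equiv : IsEquivalence _≈_
    Adj     : V → V → Set
    Adj-resp : ∀ {x x' y y'} → x ≈ x' → y ≈ y' → Adj x y → Adj x' y'
    Adj-sym  : ∀ {x y} → Adj x y → Adj y x
    Adj-irr  : ∀ {x y} → x ≈ y → ¬ Adj x y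

module _ (G : SGraph) where
  open SGraph G

  data Walk (Ok : V → V → Set) : V → V → Set where
    here : ∀ {x y} → x ≈ y → Walk Ok x y
    step : ∀ {x z y} → Adj x z → Ok x z → Walk Ok z y → Walk Ok x y

  Conn : V → V → Set
  Conn = Walk (λ _ _ → Data.Unit.⊤)
    where import Data.Unit

  Connected : Set
  Connected = V × (∀ x y → Conn x y)

  SameEdge : V → V → V → V → Set
  SameEdge x z a b = (x ≈ a × z ≈ b) ⊎ (x ≈ b × z ≈ a)

  -- the edge ab is a bridge: removing it disconnects a from b
  -- (equivalently, increases the number of connected components)
  IsBridge : V → V → Set
  IsBridge a b = Adj a b × ¬ Walk (λ x z → ¬ SameEdge x z a b) a b

  data _~_ : V → V → Set where
    base   : ∀ {x y} → x ≈ y → x ~ y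
    bridge : ∀ {x y} → IsBridge x y → x ~ y
    ~sym   : ∀ {x y} → x ~ y → y ~ x
    ~trans : ∀ {x y z} → x ~ y → y ~ z → x ~ z

  contract : SGraph
  contract = record
    { V = V
    ; _≈_ = _~_
    ; ≈-equiv = record { refl = base (IsEquivalence.refl ≈-equiv)
                       ; sym = ~sym ; trans = ~trans }
    ; Adj = λ x y → (Σ[ x' ∈ V ] Σ[ y' ∈ V ] (x ~ x' × y ~ y' × Adj x' y')) × ¬ (x ~ y)
    ; Adj-resp = λ { p q ((x' , y' , p' , q' , e) , ne) →
        (x' , y' , ~trans (~sym p) p' , ~trans (~sym q) q' , e) ,
        (λ r → ne (~trans p (~trans r (~sym q)))) }
    ; Adj-sym = λ { ((x' , y' , p' , q' , e) , ne) →
        (y' , x' , q' , p' , Adj-sym e) , (λ r → ne (~sym r)) }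
    ; Adj-irr = λ r a → proj₂ a r
    }

  -- induced subgraph on the vertices satisfying P (P must respect ≈)
  induced : (P : V → Set) → SGraph
  induced P = record
    { V = Σ V P
    ; _≈_ = λ u v → proj₁ u ≈ proj₁ v
    ; ≈-equiv = record { refl = IsEquivalence.refl ≈-equiv
                       ; sym = IsEquivalence.sym ≈-equiv
                       ; trans = IsEquivalence.trans ≈-equiv }
    ; Adj = λ u v → Adj (proj₁ u) (proj₁ v)
    ; Adj-resp = Adj-resp
    ; Adj-sym = Adj-sym
    ; Adj-irr = Adj-irr
    }

  delete : V → SGraph
  delete v = induced (λ u → ¬ (u ≈ v))

  component : V → SGraph
  component v = induced (Conn v)

-- Bridge-depth: BdLe k G  means  bd(G) ≤ k, following the recursive
-- definition of bd clause by clause.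

data BdLe : ℕ → SGraph → Set₁ where
  bd-empty : ∀ {k G} → ¬ SGraph.V G → BdLe k G
  -- disconnected G: bd(G) = max over components
  bd-disconnected : ∀ {k G} → ¬ Connected G →
    (∀ v → BdLe k (component G v)) → BdLe k G
  -- connected nonempty G: bd(G) = 1 + min_{v ∈ V(Ḡ)} bd(Ḡ ∖ v)
  bd-connected : ∀ {k G} → Connected G →
    (v : SGraph.V (contract G)) → BdLe k (delete (contract G) v) →
    BdLe (suc k) G

toSGraph : ∀ {n} → SimpleGraph n → SGraph
toSGraph G = record
  { V = Fin _
  ; _≈_ = _≡_
  ; ≈-equiv = isEquivalence
  ; Adj = λ i j → adj G i j ≡ true
  ; Adj-resp = λ { refl refl e → e }
  ; Adj-sym = λ {i} {j} e → trans (sym (adj-sym G i j)) e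
  ; Adj-irr = λ { {i} refl e → f≢t (trans (sym (adj-irr G i)) e) }
  }
  where
  f≢t : false ≡ true → Data.Empty.⊥
  f≢t ()

-- Start from K₂ with Y = V(K₂) and iterate a doubling step. From (G, Y) build G′: two
-- disjoint copies of G plus two adjacent apexes r₁, r₂, with r_b joined to the copy of Y in copy b;
-- let Y′ be the union of the two copies of Y.
--
-- Minimality is carried by a certificate: α(G) = a + 1, α(G ∖ Y) = a, and every y ∈ Y lies in a
-- maximum independent set meeting Y only in y. It survives doubling with a ↦ 2a + 1, since an
-- independent set of G′ contains at most one apex, and containing r_b forces it to avoid Y in copy b.
--
-- Bridge-depth: if every endpoint of every edge of G reaches Y without using that edge, then every
-- edge of G′ other than r₁r₂ lies on a cycle through an apex, and G′ inherits the property. So r₁r₂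
-- is the only bridge; contracting it and deleting the merged vertex leaves two copies of G, whence
-- bd(G′) ≤ bd(G) + 1, while |Y′| = 2|Y|.

module Submission where

open import Defs
open import Data.Bool using (Bool; true; false; not; if_then_else_)
open import Data.Bool.Properties using (if-eta)
open import Data.Empty using (⊥-elim)
open import Data.Fin using (Fin; zero; suc; _↑ˡ_; _↑ʳ_; splitAt)
open import Data.Fin.Properties using (_≟_; splitAt-↑ˡ; splitAt-↑ʳ; splitAt⁻¹-↑ˡ; splitAt⁻¹-↑ʳ)
open import Data.Fin.Subset
  using (Subset; ∣_∣; _∈_; _∉_; _⊆_; _⊂_; ⊤; ⊥; ∁; ⁅_⁆; Nonempty; inside; outside)
open import Data.Fin.Subset.Properties
  using (_⊆?_; ∈⊤; ∉⊥; Empty-unique; ∣⊥∣≡0; x∈⁅y⁆⇒x≡y; ∣⁅x⁆∣≡1; x∈∁p⇒x∉p; x∉p⇒x∈∁p)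
open import Data.List as List using (filter; _∷_; [])
open import Data.List.Membership.Propositional using () renaming (_∈_ to _∈ₗ_)
open import Data.List.Membership.Propositional.Properties
  using (∈-++⁺ˡ; ∈-++⁺ʳ; ∈-map⁺; ∈-map⁻; ∈-filter⁺; ∈-filter⁻)
import Data.List.Relation.Unary.Any as Any
open import Data.Nat using (ℕ; zero; suc; _+_; _≤_; _^_; z≤n; s≤s)
open import Data.Nat.Properties
  using (≤-trans; ≤-reflexive; <⇒≱; m≤m⊔n; m≤n⊔m; ⊔-lub; +-mono-≤; +-monoʳ-≤; +-suc; +-identityʳ; n≤1+n;
         module ≤-Reasoning)
open import Data.Product using (Σ-syntax; _×_; _,_; proj₁; proj₂; uncurry)
open import Data.Sum using (_⊎_; inj₁; inj₂)
open import Data.Unit using (tt)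
open import Data.Vec as Vec using (_∷_; []; _++_; lookup)
open import Data.Vec.Properties using ([]=⇒lookup; lookup⇒[]=; lookup-++ˡ; lookup-++ʳ)
open import Function using (_∘_)
open import Relation.Binary using (IsEquivalence)
open import Relation.Binary.PropositionalEquality
  using (_≡_; _≢_; refl; sym; trans; cong; cong₂; subst; subst₂; module ≡-Reasoning)
open import Relation.Nullary using (¬_; Dec; yes; no)
open import Relation.Nullary.Decidable using (_×-dec_)

-- Independence number and blocking sets

∈-allSubsets : ∀ {n} (S : Subset n) → S ∈ₗ allSubsets n
∈-allSubsets []            = Any.here refl
∈-allSubsets (outside ∷ S) = ∈-++⁺ˡ (∈-map⁺ (outside ∷_) (∈-allSubsets S))
∈-allSubsets {suc n} (inside ∷ S) =
  ∈-++⁺ʳ (List.map (outside ∷_) (allSubsets n)) (∈-map⁺ (inside ∷_) (∈-allSubsets S))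

≤-maximum : ∀ {x} xs → x ∈ₗ xs → x ≤ maximum xs
≤-maximum (y ∷ ys) (Any.here refl) = m≤m⊔n y (maximum ys)
≤-maximum (y ∷ ys) (Any.there x∈ys) = ≤-trans (≤-maximum ys x∈ys) (m≤n⊔m y (maximum ys))

maximum-≤ : ∀ {k} xs → (∀ {x} → x ∈ₗ xs → x ≤ k) → maximum xs ≤ k
maximum-≤ []       _     = z≤n
maximum-≤ (y ∷ ys) bound = ⊔-lub (bound (Any.here refl)) (maximum-≤ ys (bound ∘ Any.there))

module _ {n} (G : SimpleGraph n) (U : Subset n) where

  private
    candidate? : (S : Subset n) → Dec (S ⊆ U × Independent G S)
    candidate? S = (S ⊆? U) ×-dec independent? G S

  independent⇒≤α : ∀ S → S ⊆ U → Independent G S → ∣ S ∣ ≤ α[ G on U ]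
  independent⇒≤α S S⊆U ind =
    ≤-maximum _ (∈-map⁺ ∣_∣ (∈-filter⁺ candidate? (∈-allSubsets S) (S⊆U , ind)))

  α≤ : ∀ k → (∀ S → S ⊆ U → Independent G S → ∣ S ∣ ≤ k) → α[ G on U ] ≤ k
  α≤ k bound = maximum-≤ _ candidate-≤
    where
    candidate-≤ : ∀ {x} → x ∈ₗ List.map ∣_∣ (filter candidate? (allSubsets n)) → x ≤ k
    candidate-≤ x∈ with ∈-map⁻ ∣_∣ x∈
    ... | S , S∈ , refl = uncurry (bound S) (proj₂ (∈-filter⁻ candidate? {xs = allSubsets n} S∈))

Disjoint : ∀ {n} → Subset n → Subset n → Set
Disjoint S Y = ∀ {x} → x ∈ S → x ∉ Y

IndependentThrough : ∀ {n} → SimpleGraph n → Subset n → Fin n → ℕ → Set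
IndependentThrough G Y y k =
  Σ[ S ∈ Subset _ ] (Independent G S × (∀ {x} → x ∈ S → x ∈ Y → x ≡ y) × ∣ S ∣ ≡ k)

record BlockingCertificate {n} (G : SimpleGraph n) (Y : Subset n) (a : ℕ) : Set where
  field
    independent-≤          : ∀ S → Independent G S → ∣ S ∣ ≤ suc a
    disjoint-independent-≤ : ∀ S → Independent G S → Disjoint S Y → ∣ S ∣ ≤ a
    avoider                : Subset n
    avoider-independent    : Independent G avoider
    avoider-disjoint       : Disjoint avoider Y
    ∣avoider∣              : ∣ avoider ∣ ≡ a
    through                : ∀ {y} → y ∈ Y → IndependentThrough G Y y (suc a)

module _ {n} {G : SimpleGraph n} {Y : Subset n} {a : ℕ} (cert : BlockingCertificate G Y a) where
  open BlockingCertificate cert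

  ≤α-through : ∀ {U y} → y ∈ Y → (∀ {x} → (x ∈ Y → x ≡ y) → x ∈ U) → suc a ≤ α[ G on U ]
  ≤α-through y∈Y into-U with through y∈Y
  ... | S , S-independent , S-only , ∣S∣ =
    subst (_≤ α[ G on _ ]) ∣S∣ (independent⇒≤α G _ S (into-U ∘ S-only) S-independent)

  certificate⇒minimalBlocking : Nonempty Y → MinimalBlocking G Y
  certificate⇒minimalBlocking (y , y∈Y) = blocking , minimal
    where
    blocking : Blocking G Y
    blocking = ≤-trans
      (s≤s (α≤ G (∁ Y) a λ S S⊆∁Y ind → disjoint-independent-≤ S ind (x∈∁p⇒x∉p ∘ S⊆∁Y)))
      (≤α-through y∈Y (λ _ → ∈⊤))
    minimal : ∀ Z → Z ⊂ Y → ¬ Blocking G Z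
    minimal Z (Z⊆Y , z , z∈Y , z∉Z) Z-blocks = <⇒≱ Z-blocks (begin
      α G             ≤⟨ α≤ G ⊤ (suc a) (λ S _ → independent-≤ S) ⟩
      suc a           ≤⟨ ≤α-through z∈Y outside-Z ⟩
      α[ G on ∁ Z ]   ∎)
      where
      open ≤-Reasoning
      outside-Z : ∀ {x} → (x ∈ Y → x ≡ z) → x ∈ ∁ Z
      outside-Z only = x∉p⇒x∈∁p λ x∈Z → z∉Z (subst (_∈ Z) (only (Z⊆Y x∈Z)) x∈Z)

-- Bridge-depth is invariant under isomorphism

record Hom (A B : SGraph) : Set where
  field
    map     : SGraph.V A → SGraph.V B
    map-≈   : ∀ {x y} → SGraph._≈_ A x y → SGraph._≈_ B (map x) (map y)
    map-adj : ∀ {x y} → SGraph.Adj A x y → SGraph.Adj B (map x) (map y)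

Walk-map : ∀ {A B} (h : Hom A B) {OkA OkB} →
           (∀ {u w} → OkA u w → OkB (Hom.map h u) (Hom.map h w)) →
           ∀ {x y} → Walk A OkA x y → Walk B OkB (Hom.map h x) (Hom.map h y)
Walk-map h ok (here x≈y)   = here (Hom.map-≈ h x≈y)
Walk-map h ok (step a o w) = step (Hom.map-adj h a) (ok o) (Walk-map h ok w)

Conn-map : ∀ {A B} (h : Hom A B) {x y} → Conn A x y → Conn B (Hom.map h x) (Hom.map h y)
Conn-map h = Walk-map h (λ _ → tt)

module _ {A : SGraph} where
  open SGraph A
  private module ≈ = IsEquivalence ≈-equiv

  Walk-resp : ∀ {Ok} → (∀ {x x' z} → x' ≈ x → Ok x z → Ok x' z) →
              ∀ {x x' y y'} → x' ≈ x → Walk A Ok x y → y ≈ y' → Walk A Ok x' y'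
  Walk-resp Ok-resp x'≈x (here x≈y)   y≈y' = here (≈.trans x'≈x (≈.trans x≈y y≈y'))
  Walk-resp Ok-resp x'≈x (step a o w) y≈y' =
    step (Adj-resp (≈.sym x'≈x) ≈.refl a) (Ok-resp x'≈x o) (Walk-resp Ok-resp ≈.refl w y≈y')

  Conn-resp : ∀ {x x' y y'} → x' ≈ x → Conn A x y → y ≈ y' → Conn A x' y'
  Conn-resp = Walk-resp (λ _ o → o)

  ¬SameEdge-resp : ∀ {a b x x' z} → x' ≈ x → ¬ SameEdge A x z a b → ¬ SameEdge A x' z a b
  ¬SameEdge-resp x'≈x ¬same (inj₁ (x'≈a , z≈b)) = ¬same (inj₁ (≈.trans (≈.sym x'≈x) x'≈a , z≈b))
  ¬SameEdge-resp x'≈x ¬same (inj₂ (x'≈b , z≈a)) = ¬same (inj₂ (≈.trans (≈.sym x'≈x) x'≈b , z≈a))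

record _≅_ (A B : SGraph) : Set where
  field
    to      : Hom A B
    from    : Hom B A
    from∘to : ∀ x → SGraph._≈_ A (Hom.map from (Hom.map to x)) x
    to∘from : ∀ y → SGraph._≈_ B (Hom.map to (Hom.map from y)) y

≅-sym : ∀ {A B} → A ≅ B → B ≅ A
≅-sym I = record { to = from ; from = to ; from∘to = to∘from ; to∘from = from∘to }
  where open _≅_ I

module _ {A B : SGraph} (I : A ≅ B) where
  private
    module A = SGraph A
    module B = SGraph B
    module ≈A = IsEquivalence A.≈-equiv
    module ≈B = IsEquivalence B.≈-equiv
  open _≅_ I
  open Hom to renaming (map to f; map-≈ to f-≈; map-adj to f-adj)
  open Hom from renaming (map to g; map-≈ to g-≈; map-adj to g-adj)

  Connected-≅ : Connected A → Connected B
  Connected-≅ (v , conn) = f v , λ x y →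
    Conn-resp (≈B.sym (to∘from x)) (Conn-map to (conn (g x) (g y))) (to∘from y)

  IsBridge-≅ : ∀ {a b} → IsBridge A a b → IsBridge B (f a) (f b)
  IsBridge-≅ {a} {b} (ab , ¬avoid) = f-adj ab , λ w →
    ¬avoid (Walk-resp (¬SameEdge-resp {A = A}) (≈A.sym (from∘to a)) (Walk-map from pull w) (from∘to b))
    where
    push : ∀ {u v} → g u A.≈ v → u B.≈ f v
    push p = ≈B.trans (≈B.sym (to∘from _)) (f-≈ p)
    pull : ∀ {u w} → ¬ SameEdge B u w (f a) (f b) → ¬ SameEdge A (g u) (g w) a b
    pull ¬same (inj₁ (p , q)) = ¬same (inj₁ (push p , push q))
    pull ¬same (inj₂ (p , q)) = ¬same (inj₂ (push p , push q))

  ~-≅ : ∀ {x y} → _~_ A x y → _~_ B (f x) (f y)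
  ~-≅ (base x≈y)   = base (f-≈ x≈y)
  ~-≅ (bridge β)   = bridge (IsBridge-≅ β)
  ~-≅ (~sym p)     = ~sym (~-≅ p)
  ~-≅ (~trans p q) = ~trans (~-≅ p) (~-≅ q)

contract-hom : ∀ {A B} → A ≅ B → Hom (contract A) (contract B)
contract-hom {A} I = record
  { map     = f
  ; map-≈   = ~-≅ I
  ; map-adj = λ { ((x' , y' , x~x' , y~y' , e) , x≁y) →
      (f x' , f y' , ~-≅ I x~x' , ~-≅ I y~y' , Hom.map-adj to e) , λ fx~fy → x≁y (reflect fx~fy) }
  }
  where
  open _≅_ I
  f = Hom.map to
  module ≈A = IsEquivalence (SGraph.≈-equiv A)
  reflect : ∀ {x y} → _~_ _ (f x) (f y) → _~_ A x y
  reflect r = ~trans (base (≈A.sym (from∘to _))) (~trans (~-≅ (≅-sym I) r) (base (from∘to _)))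

contract-≅ : ∀ {A B} → A ≅ B → contract A ≅ contract B
contract-≅ I = record
  { to = contract-hom I ; from = contract-hom (≅-sym I)
  ; from∘to = λ x → base (from∘to x) ; to∘from = λ y → base (to∘from y) }
  where open _≅_ I

induced-≅ : ∀ {A B} (I : A ≅ B) {P Q} →
            (∀ {x} → P x → Q (Hom.map (_≅_.to I) x)) → (∀ {y} → Q y → P (Hom.map (_≅_.from I) y)) →
            induced A P ≅ induced B Q
induced-≅ I P⇒Q Q⇒P = record
  { to      = record
      { map = λ { (x , p) → Hom.map to x , P⇒Q p } ; map-≈ = Hom.map-≈ to ; map-adj = Hom.map-adj to }
  ; from    = record
      { map = λ { (y , q) → Hom.map from y , Q⇒P q } ; map-≈ = Hom.map-≈ from ; map-adj = Hom.map-adj from }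
  ; from∘to = from∘to ∘ proj₁
  ; to∘from = to∘from ∘ proj₁
  }
  where open _≅_ I

delete-≅ : ∀ {A B} (I : A ≅ B) {v w} → SGraph._≈_ B (Hom.map (_≅_.to I) v) w →
           delete A v ≅ delete B w
delete-≅ {A} {B} I {v} {w} fv≈w = induced-≅ I
  (λ x≉v fx≈w → x≉v (≈A.trans (≈A.sym (from∘to _))
                      (≈A.trans (Hom.map-≈ from (≈B.trans fx≈w (≈B.sym fv≈w))) (from∘to v))))
  (λ y≉w gy≈v → y≉w (≈B.trans (≈B.sym (to∘from _)) (≈B.trans (Hom.map-≈ to gy≈v) fv≈w)))
  where
  open _≅_ I
  module ≈A = IsEquivalence (SGraph.≈-equiv A)
  module ≈B = IsEquivalence (SGraph.≈-equiv B)

component-≅ : ∀ {A B} (I : A ≅ B) {v w} → SGraph._≈_ B (Hom.map (_≅_.to I) v) w →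
              component A v ≅ component B w
component-≅ {A} {B} I {v} {w} fv≈w = induced-≅ I
  (λ c → Conn-resp (≈B.sym fv≈w) (Conn-map to c) ≈B.refl)
  (λ c → Conn-resp (≈A.trans (≈A.sym (from∘to v)) (Hom.map-≈ from fv≈w)) (Conn-map from c) ≈A.refl)
  where
  open _≅_ I
  module ≈A = IsEquivalence (SGraph.≈-equiv A)
  module ≈B = IsEquivalence (SGraph.≈-equiv B)

BdLe-≅ : ∀ {k A B} → BdLe k A → A ≅ B → BdLe k B
BdLe-≅ (bd-empty ¬v) I = bd-empty (¬v ∘ Hom.map (_≅_.from I))
BdLe-≅ (bd-disconnected ¬conn bd) I =
  bd-disconnected (¬conn ∘ Connected-≅ (≅-sym I))
    (λ w → BdLe-≅ (bd (Hom.map (_≅_.from I) w)) (component-≅ I (_≅_.to∘from I w)))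
BdLe-≅ {B = B} (bd-connected conn v bd) I =
  bd-connected (Connected-≅ I conn) (Hom.map (_≅_.to I) v)
    (BdLe-≅ bd (delete-≅ (contract-≅ I) (base (IsEquivalence.refl (SGraph.≈-equiv B)))))

true≢false : true ≢ false
true≢false ()

adj⇒≢ : ∀ {n} (G : SimpleGraph n) {i j} → adj G i j ≡ true → i ≢ j
adj⇒≢ G {i} e refl = true≢false (trans (sym e) (adj-irr G i))

module _ {m} {H : SimpleGraph m} {Ok : Fin m → Fin m → Set} where

  _++ʷ_ : ∀ {x y z} → Walk (toSGraph H) Ok x y → Walk (toSGraph H) Ok y z →
          Walk (toSGraph H) Ok x z
  here refl  ++ʷ w' = w'
  step a o w ++ʷ w' = step a o (w ++ʷ w')

  reverseʷ : (∀ {u w} → Ok u w → Ok w u) →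
             ∀ {x y} → Walk (toSGraph H) Ok x y → Walk (toSGraph H) Ok y x
  reverseʷ Ok-sym (here refl)  = here refl
  reverseʷ Ok-sym (step a o w) =
    reverseʷ Ok-sym w ++ʷ step (SGraph.Adj-sym (toSGraph H) a) (Ok-sym o) (here refl)

Avoiding : ∀ {m} → SimpleGraph m → Fin m → Fin m → Fin m → Fin m → Set
Avoiding H a b = Walk (toSGraph H) (λ u w → ¬ SameEdge (toSGraph H) u w a b)

module _ {m} {H : SimpleGraph m} {a b : Fin m} where

  Avoiding-reverse : ∀ {x y} → Avoiding H a b x y → Avoiding H a b y x
  Avoiding-reverse = reverseʷ λ { ¬same (inj₁ (w≡a , u≡b)) → ¬same (inj₂ (u≡b , w≡a))
                                ; ¬same (inj₂ (w≡b , u≡a)) → ¬same (inj₁ (u≡a , w≡b)) }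

  Avoiding-swap : ∀ {x y} → Avoiding H a b x y → Avoiding H b a x y
  Avoiding-swap (here x≡y)   = here x≡y
  Avoiding-swap (step e o w) =
    step e (λ { (inj₁ p) → o (inj₂ p) ; (inj₂ p) → o (inj₁ p) }) (Avoiding-swap w)

Conn-reverse : ∀ {m} {H : SimpleGraph m} {x y} → Conn (toSGraph H) x y → Conn (toSGraph H) y x
Conn-reverse = reverseʷ (λ _ → tt)

Escape : ∀ {m} → SimpleGraph m → Subset m → Fin m → Fin m → Set
Escape H Z a b = Σ[ y ∈ Fin _ ] (y ∈ Z × Avoiding H a b a y)

record Anchored {n} (G : SimpleGraph n) (Y : Subset n) : Set where
  field
    connected : ∀ i j → Conn (toSGraph G) i j
    y₁ y₂     : Fin n
    y₁∈Y      : y₁ ∈ Y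
    y₂∈Y      : y₂ ∈ Y
    y₁≢y₂     : y₁ ≢ y₂
    escape    : ∀ {i j} → adj G i j ≡ true → Escape G Y i j

-- The doubling construction

∈-++ˡ⁺ : ∀ {m n} {L : Subset m} (R : Subset n) {i} → i ∈ L → i ↑ˡ n ∈ L ++ R
∈-++ˡ⁺ {L = L} R {i} i∈L = lookup⇒[]= _ _ (trans (lookup-++ˡ L R i) ([]=⇒lookup i∈L))

∈-++ˡ⁻ : ∀ {m n} (L : Subset m) {R : Subset n} i → i ↑ˡ n ∈ L ++ R → i ∈ L
∈-++ˡ⁻ L {R} i i∈L++R = lookup⇒[]= i L (trans (sym (lookup-++ˡ L R i)) ([]=⇒lookup i∈L++R))

∈-++ʳ⁺ : ∀ {m n} (L : Subset m) {R : Subset n} {j} → j ∈ R → m ↑ʳ j ∈ L ++ R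
∈-++ʳ⁺ L {R} {j} j∈R = lookup⇒[]= _ _ (trans (lookup-++ʳ L R j) ([]=⇒lookup j∈R))

∈-++ʳ⁻ : ∀ {m n} (L : Subset m) {R : Subset n} j → m ↑ʳ j ∈ L ++ R → j ∈ R
∈-++ʳ⁻ L {R} j j∈L++R = lookup⇒[]= j R (trans (sym (lookup-++ʳ L R j)) ([]=⇒lookup j∈L++R))

∣++∣ : ∀ {m n} (L : Subset m) (R : Subset n) → ∣ L ++ R ∣ ≡ ∣ L ∣ + ∣ R ∣
∣++∣ []            R = refl
∣++∣ (outside ∷ L) R = ∣++∣ L R
∣++∣ (inside ∷ L)  R = cong suc (∣++∣ L R)

∉⇒lookup≡false : ∀ {n} {Y : Subset n} {i} → i ∉ Y → lookup Y i ≡ false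
∉⇒lookup≡false {Y = Y} {i} i∉Y with lookup Y i in eq
... | true  = ⊥-elim (i∉Y (lookup⇒[]= i Y eq))
... | false = refl

data Vertex (n : ℕ) : Set where
  apex : Bool → Vertex n
  copy : Bool → Fin n → Vertex n

module Encoding (n : ℕ) where

  encode : Vertex n → Fin (2 + (n + n))
  encode (apex true)    = zero
  encode (apex false)   = suc zero
  encode (copy true i)  = suc (suc (i ↑ˡ n))
  encode (copy false i) = suc (suc (n ↑ʳ i))

  decode : Fin (2 + (n + n)) → Vertex n
  decode zero          = apex true
  decode (suc zero)    = apex false
  decode (suc (suc x)) with splitAt n x
  ... | inj₁ i = copy true i
  ... | inj₂ i = copy false i

  decode∘encode : ∀ v → decode (encode v) ≡ v
  decode∘encode (apex true)    = refl
  decode∘encode (apex false)   = refl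
  decode∘encode (copy true i)  rewrite splitAt-↑ˡ n i n = refl
  decode∘encode (copy false i) rewrite splitAt-↑ʳ n n i = refl

  encode∘decode : ∀ x → encode (decode x) ≡ x
  encode∘decode zero          = refl
  encode∘decode (suc zero)    = refl
  encode∘decode (suc (suc x)) with splitAt n x in eq
  ... | inj₁ i = cong (λ y → suc (suc y)) (splitAt⁻¹-↑ˡ eq)
  ... | inj₂ i = cong (λ y → suc (suc y)) (splitAt⁻¹-↑ʳ eq)

  encode-injective : ∀ {v w} → encode v ≡ encode w → v ≡ w
  encode-injective {v} {w} e =
    trans (sym (decode∘encode v)) (trans (cong decode e) (decode∘encode w))

  data Encoded : Fin (2 + (n + n)) → Set where
    encoded : ∀ v → Encoded (encode v)

  view : ∀ x → Encoded x
  view x = subst Encoded (encode∘decode x) (encoded (decode x))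

  -- A subset of the doubled vertex set is s ∷ s' ∷ L ++ R: membership of the two apexes, then
  -- its traces L and R on the two copies.
  InPieces : Bool → Bool → Subset n → Subset n → Vertex n → Set
  InPieces s s' L R (apex b)   = (if b then s else s') ≡ inside
  InPieces s s' L R (copy b i) = i ∈ (if b then L else R)

  encode-∈⁺ : ∀ {s s' L R} v → InPieces s s' L R v → encode v ∈ (s ∷ s' ∷ L ++ R)
  encode-∈⁺ (apex true)             refl = Vec.here
  encode-∈⁺ (apex false)            refl = Vec.there Vec.here
  encode-∈⁺ {R = R} (copy true i)  i∈L  = Vec.there (Vec.there (∈-++ˡ⁺ R i∈L))
  encode-∈⁺ {L = L} (copy false i) i∈R  = Vec.there (Vec.there (∈-++ʳ⁺ L i∈R))

  encode-∈⁻ : ∀ {s s' L R} v → encode v ∈ (s ∷ s' ∷ L ++ R) → InPieces s s' L R v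
  encode-∈⁻ (apex true)             Vec.here                 = refl
  encode-∈⁻ (apex false)            (Vec.there Vec.here)     = refl
  encode-∈⁻ {L = L} (copy true i)  (Vec.there (Vec.there p)) = ∈-++ˡ⁻ L i p
  encode-∈⁻ {L = L} (copy false i) (Vec.there (Vec.there p)) = ∈-++ʳ⁻ L i p

  split-pieces : (S : Subset (2 + (n + n))) →
                 Σ[ s ∈ Bool ] Σ[ s' ∈ Bool ] Σ[ L ∈ Subset n ] Σ[ R ∈ Subset n ] S ≡ s ∷ s' ∷ L ++ R
  split-pieces (s ∷ s' ∷ T) with Vec.splitAt n T
  ... | L , R , refl = s , s' , L , R , refl

module Doubling {n : ℕ} (G : SimpleGraph n) (Y : Subset n) where

  open Encoding n

  adjᵛ : Vertex n → Vertex n → Bool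
  adjᵛ (apex true)    (apex false)   = true
  adjᵛ (apex false)   (apex true)    = true
  adjᵛ (apex true)    (copy true i)  = lookup Y i
  adjᵛ (apex false)   (copy false i) = lookup Y i
  adjᵛ (copy true i)  (apex true)    = lookup Y i
  adjᵛ (copy false i) (apex false)   = lookup Y i
  adjᵛ (copy true i)  (copy true j)  = adj G i j
  adjᵛ (copy false i) (copy false j) = adj G i j
  adjᵛ _              _              = false

  adjᵛ-sym : ∀ v w → adjᵛ v w ≡ adjᵛ w v
  adjᵛ-sym (apex true)    (apex true)     = refl
  adjᵛ-sym (apex true)    (apex false)    = refl
  adjᵛ-sym (apex false)   (apex true)     = refl
  adjᵛ-sym (apex false)   (apex false)    = refl
  adjᵛ-sym (apex true)    (copy true j)   = refl
  adjᵛ-sym (apex true)    (copy false j)  = refl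
  adjᵛ-sym (apex false)   (copy true j)   = refl
  adjᵛ-sym (apex false)   (copy false j)  = refl
  adjᵛ-sym (copy true i)  (apex true)     = refl
  adjᵛ-sym (copy true i)  (apex false)    = refl
  adjᵛ-sym (copy false i) (apex true)     = refl
  adjᵛ-sym (copy false i) (apex false)    = refl
  adjᵛ-sym (copy true i)  (copy true j)   = adj-sym G i j
  adjᵛ-sym (copy true i)  (copy false j)  = refl
  adjᵛ-sym (copy false i) (copy true j)   = refl
  adjᵛ-sym (copy false i) (copy false j)  = adj-sym G i j

  adjᵛ-irr : ∀ v → adjᵛ v v ≡ false
  adjᵛ-irr (apex true)    = refl
  adjᵛ-irr (apex false)   = refl
  adjᵛ-irr (copy true i)  = adj-irr G i
  adjᵛ-irr (copy false i) = adj-irr G i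

  N : ℕ
  N = 2 + (n + n)

  double : SimpleGraph N
  double = record
    { adj     = λ x y → adjᵛ (decode x) (decode y)
    ; adj-sym = λ x y → adjᵛ-sym (decode x) (decode y)
    ; adj-irr = λ x → adjᵛ-irr (decode x)
    }

  doubleY : Subset N
  doubleY = outside ∷ outside ∷ Y ++ Y

  apex′ : Bool → Fin N
  apex′ b = encode (apex b)

  copy′ : Bool → Fin n → Fin N
  copy′ b i = encode (copy b i)

  adj-encode : ∀ v w → adj double (encode v) (encode w) ≡ adjᵛ v w
  adj-encode v w rewrite decode∘encode v | decode∘encode w = refl

  adj-apex-apex : ∀ b → adj double (apex′ b) (apex′ (not b)) ≡ true
  adj-apex-apex true  = refl
  adj-apex-apex false = refl

  adj-apex-copy : ∀ b {i} → i ∈ Y → adj double (apex′ b) (copy′ b i) ≡ true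
  adj-apex-copy true  {i} i∈Y = trans (adj-encode (apex true) (copy true i)) ([]=⇒lookup i∈Y)
  adj-apex-copy false {i} i∈Y = trans (adj-encode (apex false) (copy false i)) ([]=⇒lookup i∈Y)

  adj-copy-copy : ∀ b i j → adj double (copy′ b i) (copy′ b j) ≡ adj G i j
  adj-copy-copy true  i j = adj-encode (copy true i) (copy true j)
  adj-copy-copy false i j = adj-encode (copy false i) (copy false j)

  data Edge : Fin N → Fin N → Set where
    apex-apex : ∀ b → Edge (apex′ b) (apex′ (not b))
    apex-copy : ∀ b {i} → i ∈ Y → Edge (apex′ b) (copy′ b i)
    copy-apex : ∀ b {i} → i ∈ Y → Edge (copy′ b i) (apex′ b)
    copy-copy : ∀ b {i j} → adj G i j ≡ true → Edge (copy′ b i) (copy′ b j)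

  edge-view : ∀ {x y} → adj double x y ≡ true → Edge x y
  edge-view {x} {y} e with view x | view y
  ... | encoded v | encoded w = edgeᵛ v w (trans (sym (adj-encode v w)) e)
    where
    edgeᵛ : ∀ v w → adjᵛ v w ≡ true → Edge (encode v) (encode w)
    edgeᵛ (apex true)    (apex false)   _ = apex-apex true
    edgeᵛ (apex false)   (apex true)    _ = apex-apex false
    edgeᵛ (apex true)    (copy true i)  e = apex-copy true (lookup⇒[]= i Y e)
    edgeᵛ (apex false)   (copy false i) e = apex-copy false (lookup⇒[]= i Y e)
    edgeᵛ (copy true i)  (apex true)    e = copy-apex true (lookup⇒[]= i Y e)
    edgeᵛ (copy false i) (apex false)   e = copy-apex false (lookup⇒[]= i Y e)
    edgeᵛ (copy true i)  (copy true j)  e = copy-copy true e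
    edgeᵛ (copy false i) (copy false j) e = copy-copy false e
    edgeᵛ (apex true)    (apex true)    ()
    edgeᵛ (apex false)   (apex false)   ()
    edgeᵛ (apex true)    (copy false i) ()
    edgeᵛ (apex false)   (copy true i)  ()
    edgeᵛ (copy true i)  (apex false)   ()
    edgeᵛ (copy false i) (apex true)    ()
    edgeᵛ (copy true i)  (copy false j) ()
    edgeᵛ (copy false i) (copy true j)  ()

  copy′-injective : ∀ {b b' i j} → copy′ b i ≡ copy′ b' j → b ≡ b' × i ≡ j
  copy′-injective e with encode-injective e
  ... | refl = refl , refl

  copy′≢apex′ : ∀ {b b' i} → copy′ b i ≢ apex′ b'
  copy′≢apex′ e with encode-injective e
  ... | ()

  copy′∈doubleY : ∀ b {i} → i ∈ Y → copy′ b i ∈ doubleY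
  copy′∈doubleY b {i} i∈Y =
    encode-∈⁺ {L = Y} {R = Y} (copy b i) (subst (i ∈_) (sym (if-eta b)) i∈Y)

  ∈doubleY⇒copy : ∀ {x} → x ∈ doubleY → Σ[ b ∈ Bool ] Σ[ i ∈ Fin n ] (i ∈ Y × x ≡ copy′ b i)
  ∈doubleY⇒copy {x} x∈Y′ with view x
  ... | encoded (apex b)   = ⊥-elim (apex∉ b (encode-∈⁻ {L = Y} {R = Y} (apex b) x∈Y′))
    where
    apex∉ : ∀ b → (if b then outside else outside) ≢ inside
    apex∉ b e with trans (sym (if-eta b)) e
    ... | ()
  ... | encoded (copy b i) =
    b , i , subst (i ∈_) (if-eta b) (encode-∈⁻ {L = Y} {R = Y} (copy b i) x∈Y′) , refl

  record IndependentPieces (s s' : Bool) (L R : Subset n) : Set where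
    field
      left-independent  : Independent G L
      right-independent : Independent G R
      not-both-apexes   : s ≡ inside → s' ≢ inside
      left-disjoint     : s ≡ inside → Disjoint L Y
      right-disjoint    : s' ≡ inside → Disjoint R Y

  independent⇒pieces : ∀ {s s' L R} → Independent double (s ∷ s' ∷ L ++ R) →
                        IndependentPieces s s' L R
  independent⇒pieces {s} {s'} {L} {R} ind = record
    { left-independent  = λ i j → non-adjacent (copy true i) (copy true j)
    ; right-independent = λ i j → non-adjacent (copy false i) (copy false j)
    ; not-both-apexes   = λ s∈ s'∈ → true≢false (non-adjacent (apex true) (apex false) s∈ s'∈)
    ; left-disjoint     = λ s∈ {i} i∈L i∈Y →
        true≢false (trans (sym ([]=⇒lookup i∈Y)) (non-adjacent (apex true) (copy true i) s∈ i∈L))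
    ; right-disjoint    = λ s'∈ {i} i∈R i∈Y →
        true≢false (trans (sym ([]=⇒lookup i∈Y)) (non-adjacent (apex false) (copy false i) s'∈ i∈R))
    }
    where
    non-adjacent : ∀ v w → InPieces s s' L R v → InPieces s s' L R w → adjᵛ v w ≡ false
    non-adjacent v w v∈ w∈ = trans (sym (adj-encode v w)) (ind _ _ (encode-∈⁺ v v∈) (encode-∈⁺ w w∈))

  pieces⇒independent : ∀ {s s' L R} → IndependentPieces s s' L R →
                        Independent double (s ∷ s' ∷ L ++ R)
  pieces⇒independent {s} {s'} {L} {R} P x y x∈ y∈ with view x | view y
  ... | encoded v | encoded w =
    trans (adj-encode v w) (non-adjacent v w (encode-∈⁻ v x∈) (encode-∈⁻ w y∈))
    where
    open IndependentPieces P
    non-adjacent : ∀ v w → InPieces s s' L R v → InPieces s s' L R w → adjᵛ v w ≡ false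
    non-adjacent (apex true)    (apex true)    _   _   = refl
    non-adjacent (apex true)    (apex false)   p   q   = ⊥-elim (not-both-apexes p q)
    non-adjacent (apex false)   (apex true)    p   q   = ⊥-elim (not-both-apexes q p)
    non-adjacent (apex false)   (apex false)   _   _   = refl
    non-adjacent (apex true)    (copy true i)  p   i∈L = ∉⇒lookup≡false (left-disjoint p i∈L)
    non-adjacent (apex true)    (copy false i) _   _   = refl
    non-adjacent (apex false)   (copy true i)  _   _   = refl
    non-adjacent (apex false)   (copy false i) p   i∈R = ∉⇒lookup≡false (right-disjoint p i∈R)
    non-adjacent (copy true i)  (apex true)    i∈L p   = ∉⇒lookup≡false (left-disjoint p i∈L)
    non-adjacent (copy true i)  (apex false)   _   _   = refl
    non-adjacent (copy false i) (apex true)    _   _   = refl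
    non-adjacent (copy false i) (apex false)   i∈R p   = ∉⇒lookup≡false (right-disjoint p i∈R)
    non-adjacent (copy true i)  (copy true j)  i∈L j∈L = left-independent i j i∈L j∈L
    non-adjacent (copy true i)  (copy false j) _   _   = refl
    non-adjacent (copy false i) (copy true j)  _   _   = refl
    non-adjacent (copy false i) (copy false j) i∈R j∈R = right-independent i j i∈R j∈R

  double-certificate : ∀ {a} → BlockingCertificate G Y a →
                       BlockingCertificate double doubleY (a + suc a)
  double-certificate {a} cert = record
    { independent-≤          = bound
    ; disjoint-independent-≤ = disjoint-bound
    ; avoider                = avoider′
    ; avoider-independent    = pieces⇒independent (record
        { left-independent = avoider-independent ; right-independent = avoider-independent
        ; not-both-apexes  = λ _ () ; left-disjoint = λ _ → avoider-disjoint ; right-disjoint = λ () })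
    ; avoider-disjoint       = avoider′-disjoint
    ; ∣avoider∣              =
        trans (cong suc (trans (∣++∣ avoider avoider) (cong₂ _+_ ∣avoider∣ ∣avoider∣))) (sym (+-suc a a))
    ; through                = through′
    }
    where
    open BlockingCertificate cert

    bound : ∀ S → Independent double S → ∣ S ∣ ≤ suc (a + suc a)
    bound S ind with split-pieces S
    ... | s , s' , L , R , refl = pieces-bound s s' (independent⇒pieces ind)
      where
      pieces-bound : ∀ t t' → IndependentPieces t t' L R → ∣ t ∷ t' ∷ L ++ R ∣ ≤ suc (a + suc a)
      pieces-bound outside outside P rewrite ∣++∣ L R =
        +-mono-≤ (independent-≤ L left-independent) (independent-≤ R right-independent)
        where open IndependentPieces P
      pieces-bound inside outside P rewrite ∣++∣ L R =
        s≤s (+-mono-≤ (disjoint-independent-≤ L left-independent (left-disjoint refl))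
                      (independent-≤ R right-independent))
        where open IndependentPieces P
      pieces-bound outside inside P rewrite ∣++∣ L R | +-suc a a =
        s≤s (+-mono-≤ (independent-≤ L left-independent)
                      (disjoint-independent-≤ R right-independent (right-disjoint refl)))
        where open IndependentPieces P
      pieces-bound inside inside P = ⊥-elim (IndependentPieces.not-both-apexes P refl refl)

    disjoint-bound : ∀ S → Independent double S → Disjoint S doubleY → ∣ S ∣ ≤ a + suc a
    disjoint-bound S ind disj with split-pieces S
    ... | s , s' , L , R , refl = pieces-bound s s' (independent⇒pieces ind)
      where
      pieces-disjoint : ∀ b {i} → i ∈ (if b then L else R) → i ∉ Y
      pieces-disjoint b {i} i∈ i∈Y =
        disj (encode-∈⁺ {s} {s'} {L} {R} (copy b i) i∈) (copy′∈doubleY b i∈Y)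
      sum-bound : ∀ {t t'} → IndependentPieces t t' L R → ∣ L ∣ + ∣ R ∣ ≤ a + a
      sum-bound P = +-mono-≤ (disjoint-independent-≤ L left-independent (pieces-disjoint true))
                             (disjoint-independent-≤ R right-independent (pieces-disjoint false))
        where open IndependentPieces P
      pieces-bound : ∀ t t' → IndependentPieces t t' L R → ∣ t ∷ t' ∷ L ++ R ∣ ≤ a + suc a
      pieces-bound outside outside P rewrite ∣++∣ L R =
        ≤-trans (sum-bound P) (+-monoʳ-≤ a (n≤1+n a))
      pieces-bound inside  outside P rewrite ∣++∣ L R | +-suc a a = s≤s (sum-bound P)
      pieces-bound outside inside  P rewrite ∣++∣ L R | +-suc a a = s≤s (sum-bound P)
      pieces-bound inside  inside  P = ⊥-elim (IndependentPieces.not-both-apexes P refl refl)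

    avoider′ : Subset N
    avoider′ = inside ∷ outside ∷ avoider ++ avoider

    avoider′-disjoint : Disjoint avoider′ doubleY
    avoider′-disjoint x∈ x∈Y′ with ∈doubleY⇒copy x∈Y′
    ... | b , i , i∈Y , refl = avoider-disjoint
      (subst (i ∈_) (if-eta b) (encode-∈⁻ {L = avoider} {R = avoider} (copy b i) x∈)) i∈Y

    through-copy : ∀ b {i} → IndependentThrough G Y i (suc a) →
                   IndependentThrough double doubleY (copy′ b i) (suc (a + suc a))
    through-copy true {i} (T , T-independent , T-only , ∣T∣) =
      outside ∷ inside ∷ T ++ avoider ,
      pieces⇒independent (record
        { left-independent = T-independent ; right-independent = avoider-independent
        ; not-both-apexes  = λ () ; left-disjoint = λ () ; right-disjoint = λ _ → avoider-disjoint }) ,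
      only ,
      cong suc (trans (∣++∣ T avoider) (trans (cong₂ _+_ ∣T∣ ∣avoider∣) (sym (+-suc a a))))
      where
      only : ∀ {x} → x ∈ outside ∷ inside ∷ T ++ avoider → x ∈ doubleY → x ≡ copy′ true i
      only x∈ x∈Y′ with ∈doubleY⇒copy x∈Y′
      ... | true  , j , j∈Y , refl =
        cong (copy′ true) (T-only (encode-∈⁻ {L = T} {R = avoider} (copy true j) x∈) j∈Y)
      ... | false , j , j∈Y , refl =
        ⊥-elim (avoider-disjoint (encode-∈⁻ {L = T} {R = avoider} (copy false j) x∈) j∈Y)
    through-copy false {i} (T , T-independent , T-only , ∣T∣) =
      inside ∷ outside ∷ avoider ++ T ,
      pieces⇒independent (record
        { left-independent = avoider-independent ; right-independent = T-independent
        ; not-both-apexes  = λ _ () ; left-disjoint = λ _ → avoider-disjoint ; right-disjoint = λ () }) ,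
      only ,
      cong suc (trans (∣++∣ avoider T) (cong₂ _+_ ∣avoider∣ ∣T∣))
      where
      only : ∀ {x} → x ∈ inside ∷ outside ∷ avoider ++ T → x ∈ doubleY → x ≡ copy′ false i
      only x∈ x∈Y′ with ∈doubleY⇒copy x∈Y′
      ... | true  , j , j∈Y , refl =
        ⊥-elim (avoider-disjoint (encode-∈⁻ {L = avoider} {R = T} (copy true j) x∈) j∈Y)
      ... | false , j , j∈Y , refl =
        cong (copy′ false) (T-only (encode-∈⁻ {L = avoider} {R = T} (copy false j) x∈) j∈Y)

    through′ : ∀ {y} → y ∈ doubleY → IndependentThrough double doubleY y (suc (a + suc a))
    through′ y∈Y′ with ∈doubleY⇒copy y∈Y′
    ... | b , i , i∈Y , refl = through-copy b (through i∈Y)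

  adj-copy-apex : ∀ b {i} → i ∈ Y → adj double (copy′ b i) (apex′ b) ≡ true
  adj-copy-apex b {i} i∈Y = trans (adj-sym double (copy′ b i) (apex′ b)) (adj-apex-copy b i∈Y)

  IsApex : Fin N → Set
  IsApex x = Σ[ b ∈ Bool ] x ≡ apex′ b

  sideᵛ : Vertex n → Bool
  sideᵛ (apex b)   = b
  sideᵛ (copy b _) = b

  side : Fin N → Bool
  side x = sideᵛ (decode x)

  side-apex : ∀ b → side (apex′ b) ≡ b
  side-apex b = cong sideᵛ (decode∘encode (apex b))

  side-copy : ∀ b i → side (copy′ b i) ≡ b
  side-copy b i = cong sideᵛ (decode∘encode (copy b i))

  Edge-side : ∀ {x y} → Edge x y →
              side x ≡ side y ⊎ SameEdge (toSGraph double) x y (apex′ true) (apex′ false)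
  Edge-side (apex-apex true)  = inj₂ (inj₁ (refl , refl))
  Edge-side (apex-apex false) = inj₂ (inj₂ (refl , refl))
  Edge-side (apex-copy b _)   = inj₁ (trans (side-apex b) (sym (side-copy b _)))
  Edge-side (copy-apex b _)   = inj₁ (trans (side-copy b _) (sym (side-apex b)))
  Edge-side (copy-copy b _)   = inj₁ (trans (side-copy b _) (sym (side-copy b _)))

  side-Avoiding : ∀ {x y} → Avoiding double (apex′ true) (apex′ false) x y → side x ≡ side y
  side-Avoiding (here refl)  = refl
  side-Avoiding (step e o w) with Edge-side (edge-view e)
  ... | inj₁ same-side = trans same-side (side-Avoiding w)
  ... | inj₂ on-edge   = ⊥-elim (o on-edge)

  apex-bridge : IsBridge (toSGraph double) (apex′ true) (apex′ false)
  apex-bridge = adj-apex-apex true , λ w → true≢false (side-Avoiding w)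

  apex-copy-step : ∀ b {y z} → y ∈ Y → copy′ b y ≢ z →
                   Avoiding double (apex′ b) z (apex′ b) (copy′ b y)
  apex-copy-step b y∈Y y≢z = step (adj-apex-copy b y∈Y) not-same (here refl)
    where
    not-same : ¬ SameEdge (toSGraph double) (apex′ b) (copy′ b _) (apex′ b) _
    not-same (inj₁ (_ , e)) = y≢z e
    not-same (inj₂ (_ , e)) = copy′≢apex′ e

  copy-∉-apex-edge : ∀ {b i x z} → x ≡ copy′ b i →
                     ¬ SameEdge (toSGraph double) x z (apex′ true) (apex′ false)
  copy-∉-apex-edge x≡copy (inj₁ (x≡apex , _)) = copy′≢apex′ {b' = true} (trans (sym x≡copy) x≡apex)
  copy-∉-apex-edge x≡copy (inj₂ (x≡apex , _)) = copy′≢apex′ {b' = false} (trans (sym x≡copy) x≡apex)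

  ¬SameEdge-apexˡ : ∀ {b b₁ b₂ i j u} → ¬ SameEdge (toSGraph double) (apex′ b) u (copy′ b₁ i) (copy′ b₂ j)
  ¬SameEdge-apexˡ (inj₁ (e , _)) = copy′≢apex′ (sym e)
  ¬SameEdge-apexˡ (inj₂ (e , _)) = copy′≢apex′ (sym e)

  ¬SameEdge-apexʳ : ∀ {b b₁ b₂ i j u} → ¬ SameEdge (toSGraph double) u (apex′ b) (copy′ b₁ i) (copy′ b₂ j)
  ¬SameEdge-apexʳ (inj₁ (_ , e)) = copy′≢apex′ (sym e)
  ¬SameEdge-apexʳ (inj₂ (_ , e)) = copy′≢apex′ (sym e)

  copy-hom : Bool → Hom (toSGraph G) (toSGraph double)
  copy-hom b = record
    { map = copy′ b ; map-≈ = cong (copy′ b) ; map-adj = λ {i} {j} e → trans (adj-copy-copy b i j) e }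

  copy-Avoiding : ∀ b {i j x y} → Avoiding G i j x y →
                  Avoiding double (copy′ b i) (copy′ b j) (copy′ b x) (copy′ b y)
  copy-Avoiding b = Walk-map (copy-hom b) λ ¬same same → ¬same (reflect same)
    where
    reflect : ∀ {u w i j} → SameEdge (toSGraph double) (copy′ b u) (copy′ b w) (copy′ b i) (copy′ b j) →
              SameEdge (toSGraph G) u w i j
    reflect (inj₁ (p , q)) = inj₁ (proj₂ (copy′-injective p) , proj₂ (copy′-injective q))
    reflect (inj₂ (p , q)) = inj₂ (proj₂ (copy′-injective p) , proj₂ (copy′-injective q))

  copy-Conn-avoiding-apex : ∀ b {b' z x y} → Conn (toSGraph G) x y →
                            Avoiding double (apex′ b') z (copy′ b x) (copy′ b y)
  copy-Conn-avoiding-apex b = Walk-map (copy-hom b) λ _ → λ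
    { (inj₁ (e , _)) → copy′≢apex′ e ; (inj₂ (_ , e)) → copy′≢apex′ e }

  apex-to-apex : ∀ b → Conn (toSGraph double) (apex′ b) (apex′ true)
  apex-to-apex true  = here refl
  apex-to-apex false = step (adj-apex-apex false) tt (here refl)

  module Anchoring (A : Anchored G Y) where
    open Anchored A

    apex-step : ∀ b z → Σ[ y ∈ Fin n ] (y ∈ Y × Avoiding double (apex′ b) z (apex′ b) (copy′ b y))
    apex-step b z with z ≟ copy′ b y₁
    ... | yes refl = y₂ , y₂∈Y , apex-copy-step b y₂∈Y (λ e → y₁≢y₂ (sym (proj₂ (copy′-injective e))))
    ... | no z≢    = y₁ , y₁∈Y , apex-copy-step b y₁∈Y (z≢ ∘ sym)

    apex-escape : ∀ b {z} → Escape double doubleY (apex′ b) z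
    apex-escape b {z} with apex-step b z
    ... | y , y∈Y , w = copy′ b y , copy′∈doubleY b y∈Y , w

    double-escape : ∀ {x y} → adj double x y ≡ true → Escape double doubleY x y
    double-escape {x} {y} e with edge-view {x} {y} e
    ... | apex-apex b     = apex-escape b
    ... | apex-copy b _   = apex-escape b
    ... | copy-apex b i∈Y = copy′ b _ , copy′∈doubleY b i∈Y , here refl
    ... | copy-copy b e′ with escape e′
    ...   | y , y∈Y , w   = copy′ b y , copy′∈doubleY b y∈Y , copy-Avoiding b w

    apex-cycle : ∀ b {i} → Avoiding double (apex′ b) (copy′ b i) (apex′ b) (copy′ b i)
    apex-cycle b {i} with apex-step b (copy′ b i)
    ... | y , _ , w = w ++ʷ copy-Conn-avoiding-apex b (connected y i)

    copy-cycle : ∀ b {i j} → adj G i j ≡ true →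
                 Avoiding double (copy′ b i) (copy′ b j) (copy′ b i) (copy′ b j)
    copy-cycle b {i} {j} e = via-apex (escape e) (escape (trans (adj-sym G j i) e))
      where
      via-apex : Escape G Y i j → Escape G Y j i →
                 Avoiding double (copy′ b i) (copy′ b j) (copy′ b i) (copy′ b j)
      via-apex (yᵢ , yᵢ∈Y , wᵢ) (yⱼ , yⱼ∈Y , wⱼ) =
        copy-Avoiding b wᵢ ++ʷ
        step (adj-copy-apex b yᵢ∈Y) (¬SameEdge-apexʳ {b})
          (step (adj-apex-copy b yⱼ∈Y) (¬SameEdge-apexˡ {b})
            (Avoiding-reverse (copy-Avoiding b (Avoiding-swap wⱼ))))

    edge-cycle : ∀ {x y} → Edge x y → Avoiding double x y x y ⊎ (IsApex x × IsApex y)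
    edge-cycle (apex-apex b)   = inj₂ ((b , refl) , (not b , refl))
    edge-cycle (apex-copy b _) = inj₁ (apex-cycle b)
    edge-cycle (copy-apex b _) = inj₁ (Avoiding-reverse (Avoiding-swap (apex-cycle b)))
    edge-cycle (copy-copy b e) = inj₁ (copy-cycle b e)

    bridge⇒apexes : ∀ {x y} → IsBridge (toSGraph double) x y → IsApex x × IsApex y
    bridge⇒apexes {x} {y} (e , ¬cycle) with edge-cycle (edge-view {x} {y} e)
    ... | inj₁ cycle  = ⊥-elim (¬cycle cycle)
    ... | inj₂ apexes = apexes

    ~⇒≡⊎apexes : ∀ {x y} → _~_ (toSGraph double) x y → x ≡ y ⊎ (IsApex x × IsApex y)
    ~⇒≡⊎apexes (base x≡y)  = inj₁ x≡y
    ~⇒≡⊎apexes (bridge β)  = inj₂ (bridge⇒apexes β)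
    ~⇒≡⊎apexes (~sym p) with ~⇒≡⊎apexes p
    ... | inj₁ x≡y        = inj₁ (sym x≡y)
    ... | inj₂ (ax , ay)  = inj₂ (ay , ax)
    ~⇒≡⊎apexes (~trans p q) with ~⇒≡⊎apexes p | ~⇒≡⊎apexes q
    ... | inj₁ refl       | r              = r
    ... | inj₂ r          | inj₁ refl      = inj₂ r
    ... | inj₂ (ax , _)   | inj₂ (_ , az)  = inj₂ (ax , az)

    copy-~ : ∀ {x y b i} → x ≡ copy′ b i → _~_ (toSGraph double) x y → x ≡ y
    copy-~ x≡copy x~y with ~⇒≡⊎apexes x~y
    ... | inj₁ x≡y               = x≡y
    ... | inj₂ ((_ , x≡apex) , _) = ⊥-elim (copy′≢apex′ (trans (sym x≡copy) x≡apex))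

    Ḡ∖apex : SGraph
    Ḡ∖apex = delete (contract (toSGraph double)) (apex′ true)

    Remaining : Set
    Remaining = SGraph.V Ḡ∖apex

    remaining-copy : (u : Remaining) → Σ[ b ∈ Bool ] Σ[ i ∈ Fin n ] proj₁ u ≡ copy′ b i
    remaining-copy (x , x≁apex) with view x
    ... | encoded (apex true)  = ⊥-elim (x≁apex (base refl))
    ... | encoded (apex false) = ⊥-elim (x≁apex (~sym (bridge apex-bridge)))
    ... | encoded (copy b i)   = b , i , refl

    remaining-~ : (u : Remaining) → ∀ {y} → _~_ (toSGraph double) (proj₁ u) y → proj₁ u ≡ y
    remaining-~ u = copy-~ (proj₂ (proj₂ (remaining-copy u)))

    remaining-adj : ∀ {u v} → SGraph.Adj Ḡ∖apex u v → adj double (proj₁ u) (proj₁ v) ≡ true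
    remaining-adj {u} {v} ((x , y , u~x , v~y , e) , _) =
      subst₂ (λ x y → adj double x y ≡ true) (sym (remaining-~ u u~x)) (sym (remaining-~ v v~y)) e

    remaining-side : ∀ {u v} → Conn Ḡ∖apex u v → side (proj₁ u) ≡ side (proj₁ v)
    remaining-side {u} (here u~v) = cong side (remaining-~ u u~v)
    remaining-side {u} (step {_} {z} e _ w)
      with Edge-side (edge-view {proj₁ u} {proj₁ z} (remaining-adj {u} {z} e))
    ... | inj₁ same-side = trans same-side (remaining-side w)
    ... | inj₂ on-edge   = ⊥-elim (copy-∉-apex-edge (proj₂ (proj₂ (remaining-copy u))) on-edge)

    remaining-hom : Bool → Hom (toSGraph G) Ḡ∖apex
    remaining-hom b = record
      { map     = λ i → copy′ b i , λ r → copy′≢apex′ (copy-~ refl r)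
      ; map-≈   = λ i≡j → base (cong (copy′ b) i≡j)
      ; map-adj = λ {i} {j} e →
          (copy′ b i , copy′ b j , base refl , base refl , trans (adj-copy-copy b i j) e) ,
          λ r → adj⇒≢ G e (proj₂ (copy′-injective (copy-~ refl r)))
      }

    Ḡ∖apex-disconnected : ¬ Connected Ḡ∖apex
    Ḡ∖apex-disconnected (_ , conn) = true≢false (begin
      true                   ≡⟨ sym (side-copy true y₁) ⟩
      side (copy′ true y₁)   ≡⟨ remaining-side (conn (in-copy true) (in-copy false)) ⟩
      side (copy′ false y₁)  ≡⟨ side-copy false y₁ ⟩
      false                  ∎)
      where
      open ≡-Reasoning
      in-copy : Bool → Remaining
      in-copy b = Hom.map (remaining-hom b) y₁

    module Component (w : Remaining) where
      b : Bool
      b = proj₁ (remaining-copy w)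

      i₀ : Fin n
      i₀ = proj₁ (proj₂ (remaining-copy w))

      w≡copy : proj₁ w ≡ copy′ b i₀
      w≡copy = proj₂ (proj₂ (remaining-copy w))

      C : SGraph
      C = component Ḡ∖apex w

      index : (u : SGraph.V C) → Σ[ j ∈ Fin n ] proj₁ (proj₁ u) ≡ copy′ b j
      index (u , w⇝u) with remaining-copy u
      ... | b′ , j , u≡copy = j , trans u≡copy (cong (λ c → copy′ c j) b′≡b)
        where
        b′≡b : b′ ≡ b
        b′≡b = begin
          b′                 ≡⟨ sym (side-copy b′ j) ⟩
          side (copy′ b′ j)  ≡⟨ cong side (sym u≡copy) ⟩
          side (proj₁ u)     ≡⟨ sym (remaining-side w⇝u) ⟩
          side (proj₁ w)     ≡⟨ cong side w≡copy ⟩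
          side (copy′ b i₀)  ≡⟨ side-copy b i₀ ⟩
          b                  ∎
          where open ≡-Reasoning

      embedding : Hom (toSGraph G) C
      embedding = record
        { map     = λ j → Hom.map (remaining-hom b) j ,
            Conn-resp {A = Ḡ∖apex} (base w≡copy) (Conn-map (remaining-hom b) (connected i₀ j)) (base refl)
        ; map-≈   = Hom.map-≈ (remaining-hom b)
        ; map-adj = Hom.map-adj (remaining-hom b)
        }

      component≅G : C ≅ toSGraph G
      component≅G = record
        { to = record
            { map     = proj₁ ∘ index
            ; map-≈   = λ {u} {v} u~v → proj₂ (copy′-injective
                (trans (sym (proj₂ (index u))) (trans (remaining-~ (proj₁ u) u~v) (proj₂ (index v)))))
            ; map-adj = λ {u} {v} e → trans (sym (adj-copy-copy b _ _))
                (subst₂ (λ x y → adj double x y ≡ true) (proj₂ (index u)) (proj₂ (index v))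
                  (remaining-adj {proj₁ u} {proj₁ v} e))
            }
        ; from    = embedding
        ; from∘to = λ u → base (sym (proj₂ (index u)))
        ; to∘from = λ j → sym (proj₂ (copy′-injective (proj₂ (index (Hom.map embedding j)))))
        }

    to-apex : ∀ x → Conn (toSGraph double) x (apex′ true)
    to-apex x with view x
    ... | encoded (apex b)   = apex-to-apex b
    ... | encoded (copy b i) =
      Conn-map (copy-hom b) (connected i y₁) ++ʷ step (adj-copy-apex b y₁∈Y) tt (apex-to-apex b)

    double-connected : Connected (toSGraph double)
    double-connected = apex′ true , λ x y → to-apex x ++ʷ Conn-reverse (to-apex y)

    double-BdLe : ∀ {c} → BdLe c (toSGraph G) → BdLe (suc c) (toSGraph double)
    double-BdLe bd = bd-connected double-connected (apex′ true)
      (bd-disconnected Ḡ∖apex-disconnected λ w → BdLe-≅ bd (≅-sym (Component.component≅G w)))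

    double-anchored : Anchored double doubleY
    double-anchored = record
      { connected = proj₂ double-connected
      ; y₁        = copy′ true y₁
      ; y₂        = copy′ false y₁
      ; y₁∈Y      = copy′∈doubleY true y₁∈Y
      ; y₂∈Y      = copy′∈doubleY false y₁∈Y
      ; y₁≢y₂     = true≢false ∘ proj₁ ∘ copy′-injective
      ; escape    = double-escape
      }

-- The iteration from K₂

⁅⁆-independent : ∀ {n} (G : SimpleGraph n) y → Independent G ⁅ y ⁆
⁅⁆-independent G y i j i∈ j∈ rewrite x∈⁅y⁆⇒x≡y y i∈ | x∈⁅y⁆⇒x≡y y j∈ = adj-irr G y

K₂ : SimpleGraph 2
K₂ = record { adj = adjacent ; adj-sym = adjacent-sym ; adj-irr = adjacent-irr }
  where
  adjacent : Fin 2 → Fin 2 → Bool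
  adjacent zero       (suc zero) = true
  adjacent (suc zero) zero       = true
  adjacent _          _          = false
  adjacent-sym : ∀ i j → adjacent i j ≡ adjacent j i
  adjacent-sym zero       zero       = refl
  adjacent-sym zero       (suc zero) = refl
  adjacent-sym (suc zero) zero       = refl
  adjacent-sym (suc zero) (suc zero) = refl
  adjacent-irr : ∀ i → adjacent i i ≡ false
  adjacent-irr zero       = refl
  adjacent-irr (suc zero) = refl

K₂-certificate : BlockingCertificate K₂ ⊤ 0
K₂-certificate = record
  { independent-≤          = independent-≤1
  ; disjoint-independent-≤ = λ S _ S∩⊤=∅ →
      ≤-reflexive (trans (cong ∣_∣ (Empty-unique λ (_ , x∈S) → S∩⊤=∅ x∈S ∈⊤)) (∣⊥∣≡0 2))
  ; avoider                = ⊥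
  ; avoider-independent    = λ _ _ x∈⊥ → ⊥-elim (∉⊥ x∈⊥)
  ; avoider-disjoint       = λ x∈⊥ → ⊥-elim (∉⊥ x∈⊥)
  ; ∣avoider∣              = refl
  ; through                = λ {y} _ →
      ⁅ y ⁆ , ⁅⁆-independent K₂ y , (λ x∈ _ → x∈⁅y⁆⇒x≡y y x∈) , ∣⁅x⁆∣≡1 y
  }
  where
  independent-≤1 : ∀ S → Independent K₂ S → ∣ S ∣ ≤ 1
  independent-≤1 (inside ∷ inside ∷ []) ind with ind zero (suc zero) Vec.here (Vec.there Vec.here)
  ... | ()
  independent-≤1 (inside  ∷ outside ∷ []) _ = s≤s z≤n
  independent-≤1 (outside ∷ inside  ∷ []) _ = s≤s z≤n
  independent-≤1 (outside ∷ outside ∷ []) _ = z≤n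

K₂-connected : ∀ i j → Conn (toSGraph K₂) i j
K₂-connected zero       zero       = here refl
K₂-connected zero       (suc zero) = step refl tt (here refl)
K₂-connected (suc zero) zero       = step refl tt (here refl)
K₂-connected (suc zero) (suc zero) = here refl

K₂-anchored : Anchored K₂ ⊤
K₂-anchored = record
  { connected = K₂-connected
  ; y₁ = zero ; y₂ = suc zero ; y₁∈Y = ∈⊤ ; y₂∈Y = ∈⊤ ; y₁≢y₂ = λ ()
  ; escape    = λ {i} _ → i , ∈⊤ , here refl
  }

K₂-bridge : IsBridge (toSGraph K₂) zero (suc zero)
K₂-bridge = refl , λ where
  (here ())
  (step {z = zero}     () _ _)
  (step {z = suc zero} _  o _) → o (inj₁ (refl , refl))

K₂-BdLe : BdLe 1 (toSGraph K₂)
K₂-BdLe = bd-connected (zero , K₂-connected) zero (bd-empty λ where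
  (zero     , x≁0) → x≁0 (base refl)
  (suc zero , x≁0) → x≁0 (~sym (bridge K₂-bridge)))

record Stage (c : ℕ) : Set₁ where
  field
    n            : ℕ
    graph        : SimpleGraph n
    blocker      : Subset n
    a            : ℕ
    certificate  : BlockingCertificate graph blocker a
    anchored     : Anchored graph blocker
    bridge-depth : BdLe c (toSGraph graph)
    ∣blocker∣    : ∣ blocker ∣ ≡ 2 ^ c

double-stage : ∀ {c} → Stage c → Stage (suc c)
double-stage {c} S = record
  { graph        = double
  ; blocker      = doubleY
  ; certificate  = double-certificate certificate
  ; anchored     = Anchoring.double-anchored anchored
  ; bridge-depth = Anchoring.double-BdLe anchored bridge-depth
  ; ∣blocker∣    = trans (∣++∣ blocker blocker)
                     (cong₂ _+_ ∣blocker∣ (trans ∣blocker∣ (sym (+-identityʳ (2 ^ c)))))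
  }
  where
  open Stage S
  open Doubling graph blocker

K₂-stage : Stage 1
K₂-stage = record
  { graph = K₂ ; blocker = ⊤ ; certificate = K₂-certificate ; anchored = K₂-anchored
  ; bridge-depth = K₂-BdLe ; ∣blocker∣ = refl }

stage : ∀ c → Stage (suc c)
stage zero    = K₂-stage
stage (suc c) = double-stage (stage c)

theorem27 : (c : ℕ) → 1 ≤ c →
    Σ[ n ∈ ℕ ] Σ[ G ∈ SimpleGraph n ]
    (BdLe c (toSGraph G) × Σ[ Y ∈ Subset n ] (MinimalBlocking G Y × ∣ Y ∣ ≡ 2 ^ c))
theorem27 zero    ()
theorem27 (suc c) _ =
  n , graph , bridge-depth , blocker , certificate⇒minimalBlocking certificate (y₁ , y₁∈Y) , ∣blocker∣
  where
  open Stage (stage c)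
  open Anchored anchored
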